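{- Let $n=\prod_{i=1}^{r}p_i^{n_i}\prod_{i=r+1}^{s}p_i^{n_i}$ with distinct primes $p_1,\dots,p_s$, and let $k=u\prod_{i=1}^{r}p_i^{k_i}$ where $u$ is an integer with $\gcd(u,p_i)=1$ for all $i\in\{1,\dots,s\}$. Let $m$ be a divisor of $n$, written $m=\prod_{i=1}^{s}p_i^{m_i}$ with $m_i\leqslant n_i$ for all $i$. Then $$k\cdot A_m=A_{m'}\quad\text{where}\quad m'=m\prod_{i=1}^{r}p_i^{\min(k_i,\,n_i-m_i)}.$$
   Context: Everything takes place in $\mathbb{Z}/n\mathbb{Z}$. For a divisor $m$ of $n$, $A_m=\{x\in\mathbb{Z}/n\mathbb{Z} : \gcd(x,n)=m\}=\{mu : \gcd(u,n/m)=1\}$. For a set $A$, $k\cdot A=\{ka : a\in A\}$. -}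

module Defs where

open import Data.Nat using (ℕ; zero; suc; _*_; _<_; NonZero)
open import Data.Nat.GCD using (gcd)
open import Data.Fin using (Fin; zero; suc)
open import Data.Integer as ℤ using (ℤ; +_)
open import Data.Integer.DivMod using (_%ℕ_)
open import Data.Product using (Σ; ∃; _×_)
open import Relation.Binary.PropositionalEquality using (_≡_)

∏ : ∀ {s} → (Fin s → ℕ) → ℕ
∏ {zero}  f = 1
∏ {suc s} f = f zero * ∏ (λ i → f (suc i))

-- Elements of ℤ/nℤ are represented by their canonical residues x < n.
-- A_m = { x ∈ ℤ/nℤ : gcd(x,n) = m }   (as a predicate on residues)
A : (n m : ℕ) → ℕ → Set
A n m x = x < n × gcd x n ≡ m

_·_within_ : ℤ → (ℕ → Set) → (n : ℕ) → .{{NonZero n}} → ℕ → Set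
(k · S within n) y = Σ ℕ λ a → S a × y ≡ ((k ℤ.* + a) %ℕ n)

-- Write n = m·N with N = ∏ pᵢ^(nᵢ-mᵢ). An element of A_m is m·v with v prime to N, and
-- gcd(k·m·v, m·N) = m·gcd(k, N), so k·A_m ⊆ A_{m·gcd(k,N)} for every integer k. Conversely,
-- put g = gcd(k, N) and let y = w·m·g with gcd(y, n) = m·g. Writing k = k′·g and N = N′·g,
-- both k′ and w are units modulo N′, so k′·v ≡ w (mod N′) has a solution v; adding to v a
-- multiple of N′ (the product of the primes of N not dividing v) makes v prime to N, and then
-- a = m·v lies in A_m with k·a ≡ y (mod n). Finally, as u is prime to n,
-- gcd(k, N) = gcd(∏_{i≤r} pᵢ^kᵢ, N) = ∏_{i≤r} pᵢ^min(kᵢ, nᵢ-mᵢ).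

module Submission where

open import Defs
open import Algebra.Properties.CommutativeSemigroup using (interchange)
open import Data.Nat using (ℕ; zero; suc; NonZero; ≢-nonZero; ≢-nonZero⁻¹; _+_; _*_; _^_; _≤_; _<_; _∸_; _⊓_)
open import Data.Nat.Properties
open import Data.Nat.DivMod using (m<n⇒m%n≡m)
open import Data.Nat.Divisibility
open import Data.Nat.GCD
  using (gcd; gcd[m,n]≢0; gcd[m,n]∣m; gcd[m,n]∣n; gcd-greatest; gcd-comm; gcd-zeroˡ; c*gcd[m,n]≡gcd[cm,cn]; module Bézout)
open import Data.Nat.Coprimality as Coprime using (Coprime; 1-coprimeTo; coprime-divisor; coprime-Bézout; coprime⇒gcd≡1)
open import Data.Nat.Primality using (Prime; ¬prime[1]; prime⇒irreducible; euclidsLemma)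
open import Data.Nat.Primality.Factorisation using (PrimeFactorisation; factorise; factorisationHasAllPrimeFactors)
open import Data.Nat.ListAction using (product)
open import Data.Nat.ListAction.Properties using (∈⇒∣product)
open import Data.Fin using (Fin; zero; suc; _↑ˡ_; _↑ʳ_; splitAt)
import Data.Fin.Properties as Fin
open import Data.Integer as ℤ using (ℤ; +_; ∣_∣; 0ℤ; 1ℤ)
import Data.Integer.Properties as ℤ
open import Data.Integer.DivMod using (_%ℕ_; _/ℕ_; a≡a%ℕn+[a/ℕn]*n; n%ℕd<d)
import Data.Integer.Divisibility.Signed as ℤ∣
open import Data.Integer.Divisibility.Signed using (divides) renaming (_∣_ to _∣ℤ_)
open import Data.Integer.Tactic.RingSolver using (solve-∀)
open import Data.List using (filter)
open import Data.List.Membership.Propositional using (_∈_)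
open import Data.List.Membership.Propositional.Properties using (∈-filter⁺; ∈-filter⁻)
open import Data.List.Relation.Unary.All as All using (All; []; _∷_)
open import Data.List.Relation.Unary.All.Properties using (filter⁺)
open import Data.Product using (∃; _×_; _,_; proj₁; proj₂)
open import Data.Sum using (inj₁; inj₂; [_,_]′)
open import Function.Definitions using (Injective)
open import Function.Bundles using (_⇔_; mk⇔)
open import Level using (0ℓ)
open import Relation.Binary.Bundles using (Setoid)
import Relation.Binary.Reasoning.Setoid
open import Relation.Nullary using (¬_; Dec; ¬?; yes; no; contradiction)
open import Relation.Binary.PropositionalEquality

nonZero-resp : ∀ {a b} .{{_ : NonZero a}} → a ≡ b → NonZero b
nonZero-resp {a} a≡b = ≢-nonZero (subst (_≢ 0) a≡b (≢-nonZero⁻¹ a))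

∣<⇒≡0 : ∀ {n x} → n ∣ x → x < n → x ≡ 0
∣<⇒≡0 {x = zero}  _   _   = refl
∣<⇒≡0 {x = suc _} n∣x x<n = contradiction n∣x (>⇒∤ x<n)

coprime-*ʳ : ∀ {x a b} → Coprime x a → Coprime x b → Coprime x (a * b)
coprime-*ʳ x⊥a x⊥b {d} (d∣x , d∣ab) = x⊥b (d∣x , coprime-divisor d⊥a d∣ab)
  where
  d⊥a : Coprime d _
  d⊥a (e∣d , e∣a) = x⊥a (∣-trans e∣d d∣x , e∣a)

coprime-^ʳ : ∀ {x a} e → Coprime x a → Coprime x (a ^ e)
coprime-^ʳ {x} zero    _   = Coprime.sym (1-coprimeTo x)
coprime-^ʳ     (suc e) x⊥a = coprime-*ʳ x⊥a (coprime-^ʳ e x⊥a)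

coprime-∏ʳ : ∀ {x s} (f : Fin s → ℕ) → (∀ i → Coprime x (f i)) → Coprime x (∏ f)
coprime-∏ʳ {x} {zero} f _   = Coprime.sym (1-coprimeTo x)
coprime-∏ʳ {s = suc s} f x⊥f = coprime-*ʳ (x⊥f zero) (coprime-∏ʳ (λ i → f (suc i)) (λ i → x⊥f (suc i)))

coprime-productʳ : ∀ {x ps} → All (Coprime x) ps → Coprime x (product ps)
coprime-productʳ {x} []            = Coprime.sym (1-coprimeTo x)
coprime-productʳ     (x⊥p ∷ x⊥ps) = coprime-*ʳ x⊥p (coprime-productʳ x⊥ps)

prime-∤⇒coprime : ∀ {p x} → Prime p → ¬ p ∣ x → Coprime p x
prime-∤⇒coprime pp p∤x (d∣p , d∣x) with prime⇒irreducible pp d∣p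
... | inj₁ d≡1 = d≡1
... | inj₂ refl = contradiction d∣x p∤x

distinct-primes⇒coprime : ∀ {p q} → Prime p → Prime q → p ≢ q → Coprime p q
distinct-primes⇒coprime pp pq p≢q = prime-∤⇒coprime pp p∤q
  where
  p∤q : ¬ _ ∣ _
  p∤q p∣q with prime⇒irreducible pq p∣q
  ... | inj₁ refl = ¬prime[1] pp
  ... | inj₂ p≡q  = p≢q p≡q

∏-cong : ∀ {s} {f g : Fin s → ℕ} → (∀ i → f i ≡ g i) → ∏ f ≡ ∏ g
∏-cong {zero}  _   = refl
∏-cong {suc s} f≡g = cong₂ _*_ (f≡g zero) (∏-cong (λ i → f≡g (suc i)))

∏-* : ∀ {s} (f g : Fin s → ℕ) → ∏ (λ i → f i * g i) ≡ ∏ f * ∏ g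
∏-* {zero}  f g = refl
∏-* {suc s} f g = trans (cong (f zero * g zero *_) (∏-* (λ i → f (suc i)) (λ i → g (suc i))))
                        (interchange *-commutativeSemigroup (f zero) (g zero) _ _)

∏-≡1 : ∀ {s} {f : Fin s → ℕ} → (∀ i → f i ≡ 1) → ∏ f ≡ 1
∏-≡1 {zero}  _    = refl
∏-≡1 {suc s} f≡1 = cong₂ _*_ (f≡1 zero) (∏-≡1 (λ i → f≡1 (suc i)))

∏-↑ˡ : ∀ {r t} (f : Fin (r + t) → ℕ) → (∀ j → f (r ↑ʳ j) ≡ 1) → ∏ f ≡ ∏ (λ i → f (i ↑ˡ t))
∏-↑ˡ {zero}  f f≡1 = ∏-≡1 f≡1
∏-↑ˡ {suc r} f f≡1 = cong (f zero *_) (∏-↑ˡ (λ i → f (suc i)) f≡1)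

common-divisors⇒gcd≡ : ∀ {a b n} → (∀ {d} → d ∣ n → d ∣ a → d ∣ b) → (∀ {d} → d ∣ n → d ∣ b → d ∣ a)
                     → gcd a n ≡ gcd b n
common-divisors⇒gcd≡ {a} {b} {n} a⇒b b⇒a = ∣-antisym
  (gcd-greatest (a⇒b (gcd[m,n]∣n a n) (gcd[m,n]∣m a n)) (gcd[m,n]∣n a n))
  (gcd-greatest (b⇒a (gcd[m,n]∣n b n) (gcd[m,n]∣m b n)) (gcd[m,n]∣n b n))

gcd[c*m,n]≡gcd[m,n] : ∀ {c n} m → Coprime c n → gcd (c * m) n ≡ gcd m n
gcd[c*m,n]≡gcd[m,n] {c} m c⊥n = common-divisors⇒gcd≡
  (λ d∣n d∣cm → coprime-divisor (λ (e∣d , e∣c) → c⊥n (e∣c , ∣-trans e∣d d∣n)) d∣cm)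
  (λ _ d∣m → ∣n⇒∣m*n c d∣m)

gcd[m,c*n]≡gcd[m,n] : ∀ {c} m n → Coprime c m → gcd m (c * n) ≡ gcd m n
gcd[m,c*n]≡gcd[m,n] {c} m n c⊥m =
  trans (gcd-comm m (c * n)) (trans (gcd[c*m,n]≡gcd[m,n] n c⊥m) (gcd-comm n m))

gcd[a*d,b*d]≡d⇒coprime : ∀ {a b d} .{{_ : NonZero d}} → gcd (a * d) (b * d) ≡ d → Coprime a b
gcd[a*d,b*d]≡d⇒coprime {a} {b} {d} gcd≡d = Coprime.gcd≡1⇒coprime (*-cancelˡ-≡ _ 1 d (begin
  d * gcd a b             ≡⟨ c*gcd[m,n]≡gcd[cm,cn] d a b ⟩
  gcd (d * a) (d * b)     ≡⟨ cong₂ gcd (*-comm d a) (*-comm d b) ⟩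
  gcd (a * d) (b * d)     ≡⟨ gcd≡d ⟩
  d                       ≡⟨ *-identityʳ d ⟨
  d * 1                   ∎))
  where open ≡-Reasoning

gcd[pᵃx,pᵇy]≡pᵃgcd[x,y] : ∀ {p x y a b} → a ≤ b → Coprime p x
  → gcd (p ^ a * x) (p ^ b * y) ≡ p ^ a * gcd x y
gcd[pᵃx,pᵇy]≡pᵃgcd[x,y] {p} {x} {y} {a} {b} a≤b p⊥x = begin
  gcd (p ^ a * x) (p ^ b * y)                 ≡⟨ cong (λ e → gcd (p ^ a * x) (p ^ e * y)) (m+[n∸m]≡n a≤b) ⟨
  gcd (p ^ a * x) (p ^ (a + (b ∸ a)) * y)     ≡⟨ cong (gcd (p ^ a * x)) pᵇy≡pᵃ[pᵇ⁻ᵃy] ⟩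
  gcd (p ^ a * x) (p ^ a * (p ^ (b ∸ a) * y)) ≡⟨ c*gcd[m,n]≡gcd[cm,cn] (p ^ a) x _ ⟨
  p ^ a * gcd x (p ^ (b ∸ a) * y)             ≡⟨ cong (p ^ a *_) (gcd[m,c*n]≡gcd[m,n] x y pᵇ⁻ᵃ⊥x) ⟩
  p ^ a * gcd x y                             ∎
  where
  open ≡-Reasoning
  pᵇy≡pᵃ[pᵇ⁻ᵃy] : p ^ (a + (b ∸ a)) * y ≡ p ^ a * (p ^ (b ∸ a) * y)
  pᵇy≡pᵃ[pᵇ⁻ᵃy] = trans (cong (_* y) (^-distribˡ-+-* p a (b ∸ a))) (*-assoc (p ^ a) _ y)
  pᵇ⁻ᵃ⊥x : Coprime (p ^ (b ∸ a)) x
  pᵇ⁻ᵃ⊥x = Coprime.sym (coprime-^ʳ (b ∸ a) (Coprime.sym p⊥x))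

gcd[pᵃx,pᵇy]≡pᵃ⊓ᵇgcd[x,y] : ∀ {p x y} a b → Coprime p x → Coprime p y
  → gcd (p ^ a * x) (p ^ b * y) ≡ p ^ (a ⊓ b) * gcd x y
gcd[pᵃx,pᵇy]≡pᵃ⊓ᵇgcd[x,y] {p} {x} {y} a b p⊥x p⊥y with ≤-total a b
... | inj₁ a≤b = begin
  gcd (p ^ a * x) (p ^ b * y) ≡⟨ gcd[pᵃx,pᵇy]≡pᵃgcd[x,y] a≤b p⊥x ⟩
  p ^ a * gcd x y             ≡⟨ cong (λ e → p ^ e * gcd x y) (m≤n⇒m⊓n≡m a≤b) ⟨
  p ^ (a ⊓ b) * gcd x y       ∎
  where open ≡-Reasoning
... | inj₂ b≤a = begin
  gcd (p ^ a * x) (p ^ b * y) ≡⟨ gcd-comm (p ^ a * x) (p ^ b * y) ⟩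
  gcd (p ^ b * y) (p ^ a * x) ≡⟨ gcd[pᵃx,pᵇy]≡pᵃgcd[x,y] b≤a p⊥y ⟩
  p ^ b * gcd y x             ≡⟨ cong₂ (λ e g → p ^ e * g) (m≥n⇒m⊓n≡n b≤a) (gcd-comm x y) ⟨
  p ^ (a ⊓ b) * gcd x y       ∎
  where open ≡-Reasoning

gcd-∏-^ : ∀ {s} (p : Fin s → ℕ) → Injective _≡_ _≡_ p → (∀ i → Prime (p i)) → (a b : Fin s → ℕ)
  → gcd (∏ (λ i → p i ^ a i)) (∏ (λ i → p i ^ b i)) ≡ ∏ (λ i → p i ^ (a i ⊓ b i))
gcd-∏-^ {zero}  p _   _     a b = gcd-zeroˡ 1
gcd-∏-^ {suc s} p inj prime a b = trans
  (gcd[pᵃx,pᵇy]≡pᵃ⊓ᵇgcd[x,y] (a zero) (b zero) (p₀⊥ a) (p₀⊥ b))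
  (cong (p zero ^ (a zero ⊓ b zero) *_)
        (gcd-∏-^ (λ i → p (suc i)) (λ eq → Fin.suc-injective (inj eq)) (λ i → prime (suc i))
                 (λ i → a (suc i)) (λ i → b (suc i))))
  where
  p₀⊥ : ∀ e → Coprime (p zero) (∏ (λ i → p (suc i) ^ e (suc i)))
  p₀⊥ e = coprime-∏ʳ _ λ i → coprime-^ʳ (e (suc i))
    (distinct-primes⇒coprime (prime zero) (prime (suc i)) (λ eq → Fin.0≢1+n (inj eq)))

gcd-∏-^-↑ˡ : ∀ {r t} (p : Fin (r + t) → ℕ) → Injective _≡_ _≡_ p → (∀ i → Prime (p i))
  → (a : Fin r → ℕ) (b : Fin (r + t) → ℕ)
  → gcd (∏ (λ i → p (i ↑ˡ t) ^ a i)) (∏ (λ i → p i ^ b i)) ≡ ∏ (λ i → p (i ↑ˡ t) ^ (a i ⊓ b (i ↑ˡ t)))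
gcd-∏-^-↑ˡ {r} {t} p inj prime a b = begin
  gcd (∏ (λ i → p (i ↑ˡ t) ^ a i)) (∏ (λ i → p i ^ b i)) ≡⟨ cong (λ x → gcd x _) (restrict (λ _ x → x) λ _ → refl) ⟨
  gcd (∏ (λ i → p i ^ a′ i)) (∏ (λ i → p i ^ b i))       ≡⟨ gcd-∏-^ p inj prime a′ b ⟩
  ∏ (λ i → p i ^ (a′ i ⊓ b i))                            ≡⟨ restrict (λ i x → x ⊓ b i) (λ _ → refl) ⟩
  ∏ (λ i → p (i ↑ˡ t) ^ (a i ⊓ b (i ↑ˡ t)))               ∎
  where
  open ≡-Reasoning
  a′ : Fin (r + t) → ℕ
  a′ i = [ a , (λ _ → 0) ]′ (splitAt r i)
  a′-↑ˡ : ∀ i → a′ (i ↑ˡ t) ≡ a i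
  a′-↑ˡ i = cong [ a , _ ]′ (Fin.splitAt-↑ˡ r i t)
  a′-↑ʳ : ∀ j → a′ (r ↑ʳ j) ≡ 0
  a′-↑ʳ j = cong [ a , _ ]′ (Fin.splitAt-↑ʳ r t j)
  restrict : (e : Fin (r + t) → ℕ → ℕ) → (∀ i → e i 0 ≡ 0)
    → ∏ (λ i → p i ^ e i (a′ i)) ≡ ∏ (λ i → p (i ↑ˡ t) ^ e (i ↑ˡ t) (a i))
  restrict e e0≡0 = trans
    (∏-↑ˡ {r} (λ i → p i ^ e i (a′ i)) λ j → cong (p (r ↑ʳ j) ^_) (trans (cong (e (r ↑ʳ j)) (a′-↑ʳ j)) (e0≡0 (r ↑ʳ j))))
    (∏-cong (λ i → cong (λ x → p (i ↑ˡ t) ^ e (i ↑ˡ t) x) (a′-↑ˡ i)))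

infix 4 _≡_mod_

-- A record rather than a synonym for + n ∣ x - y, so that Agda can infer x and y.
record _≡_mod_ (x y : ℤ) (n : ℕ) : Set where
  constructor mod-divides
  field divides-difference : + n ∣ℤ x ℤ.- y

open _≡_mod_

≡mod-refl : ∀ {n x} → x ≡ x mod n
≡mod-refl {n} {x} = mod-divides (divides 0ℤ (trans (ℤ.+-inverseʳ x) (sym (ℤ.*-zeroˡ (+ n)))))

≡mod-sym : ∀ {n x y} → x ≡ y mod n → y ≡ x mod n
≡mod-sym {x = x} {y} (mod-divides n∣x-y) = mod-divides (subst (_ ∣ℤ_) (neg-minus x y) (ℤ∣.∣m⇒∣-m n∣x-y))
  where
  neg-minus : ∀ a b → ℤ.- (a ℤ.- b) ≡ b ℤ.- a
  neg-minus = solve-∀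

≡mod-trans : ∀ {n x y z} → x ≡ y mod n → y ≡ z mod n → x ≡ z mod n
≡mod-trans {x = x} {y} {z} (mod-divides n∣x-y) (mod-divides n∣y-z) =
  mod-divides (subst (_ ∣ℤ_) (ℤ.+-minus-telescope x y z) (ℤ∣.∣m∣n⇒∣m+n n∣x-y n∣y-z))

≡mod-setoid : ℕ → Setoid 0ℓ 0ℓ
≡mod-setoid n = record
  { Carrier       = ℤ
  ; _≈_           = _≡_mod n
  ; isEquivalence = record { refl = ≡mod-refl ; sym = ≡mod-sym ; trans = ≡mod-trans }
  }

module ≡mod-Reasoning (n : ℕ) = Relation.Binary.Reasoning.Setoid (≡mod-setoid n)

*-distribˡ-- : ∀ c x y → c ℤ.* (x ℤ.- y) ≡ c ℤ.* x ℤ.- c ℤ.* y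
*-distribˡ-- = solve-∀

≡mod-*ˡ : ∀ {n x y} c → x ≡ y mod n → c ℤ.* x ≡ c ℤ.* y mod n
≡mod-*ˡ {x = x} {y} c (mod-divides n∣x-y) =
  mod-divides (subst (_ ∣ℤ_) (*-distribˡ-- c x y) (ℤ∣.∣n⇒∣m*n c n∣x-y))

≡mod-*ʳ : ∀ {n x y} c → x ≡ y mod n → x ℤ.* c ≡ y ℤ.* c mod n
≡mod-*ʳ {n} {x} {y} c x≡y = subst₂ (_≡_mod n) (ℤ.*-comm c x) (ℤ.*-comm c y) (≡mod-*ˡ c x≡y)

≡mod-scale : ∀ {n x y} c → x ≡ y mod n → + c ℤ.* x ≡ + c ℤ.* y mod c * n
≡mod-scale {n} {x} {y} c (mod-divides n∣x-y) =
  mod-divides (subst₂ _∣ℤ_ (sym (ℤ.pos-* c n)) (*-distribˡ-- (+ c) x y) (ℤ∣.*-monoʳ-∣ (+ c) n∣x-y))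

≡mod-+-multiple : ∀ {n} x c → + (x + n * c) ≡ + x mod n
≡mod-+-multiple {n} x c = mod-divides (divides (+ c) (begin
  + (x + n * c) ℤ.- + x            ≡⟨ cong (ℤ._- + x) (trans (ℤ.pos-+ x (n * c)) (cong (λ z → + x ℤ.+ z) (ℤ.pos-* n c))) ⟩
  + x ℤ.+ + n ℤ.* + c ℤ.- + x      ≡⟨ cancel (+ x) (+ n) (+ c) ⟩
  + c ℤ.* + n                      ∎))
  where
  open ≡-Reasoning
  cancel : ∀ a b c → a ℤ.+ b ℤ.* c ℤ.- a ≡ c ℤ.* b
  cancel = solve-∀

%ℕ-≡mod : ∀ {n} .{{_ : NonZero n}} x → + (x %ℕ n) ≡ x mod n
%ℕ-≡mod {n} x = mod-divides (divides (ℤ.- (x /ℕ n)) (begin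
  + (x %ℕ n) ℤ.- x                               ≡⟨ cong (λ z → + (x %ℕ n) ℤ.- z) (a≡a%ℕn+[a/ℕn]*n x n) ⟩
  + (x %ℕ n) ℤ.- (+ (x %ℕ n) ℤ.+ x /ℕ n ℤ.* + n) ≡⟨ cancel (+ (x %ℕ n)) (x /ℕ n) (+ n) ⟩
  ℤ.- (x /ℕ n) ℤ.* + n                           ∎))
  where
  open ≡-Reasoning
  cancel : ∀ r q d → r ℤ.- (r ℤ.+ q ℤ.* d) ≡ ℤ.- q ℤ.* d
  cancel = solve-∀

≡mod-<⇒≡ : ∀ {n a b} → a < n → b < n → + a ≡ + b mod n → a ≡ b
≡mod-<⇒≡ {n} {a} {b} a<n b<n a≡b = ℤ.+-injective (ℤ.i-j≡0⇒i≡j (+ a) (+ b) (ℤ.∣i∣≡0⇒i≡0 ∣a-b∣≡0))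
  where
  ∣a-b∣<n : ∣ + a ℤ.- + b ∣ < n
  ∣a-b∣<n = subst (_< n) (cong ∣_∣ (sym (ℤ.m-n≡m⊖n a b))) (≤-<-trans (ℤ.∣m⊝n∣≤m⊔n a b) (⊔-lub a<n b<n))
  ∣a-b∣≡0 : ∣ + a ℤ.- + b ∣ ≡ 0
  ∣a-b∣≡0 = ∣<⇒≡0 (ℤ∣.∣⇒∣ᵤ (divides-difference a≡b)) ∣a-b∣<n

≡mod⇒%ℕ≡ : ∀ {n} .{{_ : NonZero n}} {x y} → x ≡ y mod n → x %ℕ n ≡ y %ℕ n
≡mod⇒%ℕ≡ {n} {x} {y} x≡y = ≡mod-<⇒≡ (n%ℕd<d x n) (n%ℕd<d y n) (begin
  + (x %ℕ n) ≈⟨ %ℕ-≡mod x ⟩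
  x          ≈⟨ x≡y ⟩
  y          ≈⟨ %ℕ-≡mod y ⟨
  + (y %ℕ n) ∎)
  where open ≡mod-Reasoning n

≡mod-∣ : ∀ {n d x y} → d ∣ n → d ∣ ∣ x ∣ → x ≡ y mod n → d ∣ ∣ y ∣
≡mod-∣ {d = d} {x} {y} d∣n d∣x x≡y = ℤ∣.∣⇒∣ᵤ (subst (+ d ∣ℤ_) (minus-minus x y)
  (ℤ∣.∣m∣n⇒∣m-n (ℤ∣.∣ᵤ⇒∣ {+ d} {x} d∣x) (ℤ∣.∣-trans (ℤ∣.∣ᵤ⇒∣ d∣n) (divides-difference x≡y))))
  where
  minus-minus : ∀ a b → a ℤ.- (a ℤ.- b) ≡ b
  minus-minus = solve-∀

≡mod⇒gcd≡ : ∀ {n x y} → x ≡ y mod n → gcd (∣ x ∣) n ≡ gcd (∣ y ∣) n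
≡mod⇒gcd≡ x≡y = common-divisors⇒gcd≡
  (λ d∣n d∣x → ≡mod-∣ d∣n d∣x x≡y) (λ d∣n d∣y → ≡mod-∣ d∣n d∣y (≡mod-sym x≡y))

≡mod-inverse⁺ : ∀ {c n} → Coprime c n → ∃ λ s → + c ℤ.* s ≡ 1ℤ mod n
≡mod-inverse⁺ {c} {n} c⊥n with coprime-Bézout c⊥n
... | Bézout.Identity.+- x y 1+yn≡xc = + x , mod-divides (divides (+ y) (begin
  + c ℤ.* + x ℤ.- 1ℤ      ≡⟨ cong (ℤ._- 1ℤ) (trans (ℤ.*-comm (+ c) (+ x)) (sym (ℤ.pos-* x c))) ⟩
  + (x * c) ℤ.- 1ℤ        ≡⟨ cong (λ z → + z ℤ.- 1ℤ) 1+yn≡xc ⟨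
  + (1 + y * n) ℤ.- 1ℤ    ≡⟨ cong (ℤ._- 1ℤ) (ℤ.pos-+ 1 (y * n)) ⟩
  1ℤ ℤ.+ + (y * n) ℤ.- 1ℤ ≡⟨ cancel 1ℤ (+ (y * n)) ⟩
  + (y * n)               ≡⟨ ℤ.pos-* y n ⟩
  + y ℤ.* + n             ∎))
  where
  open ≡-Reasoning
  cancel : ∀ a b → a ℤ.+ b ℤ.- a ≡ b
  cancel = solve-∀
... | Bézout.Identity.-+ x y 1+xc≡yn = ℤ.- + x , mod-divides (divides (ℤ.- + y) (begin
  + c ℤ.* ℤ.- + x ℤ.- 1ℤ   ≡⟨ negate (+ c) (+ x) ⟩
  ℤ.- (1ℤ ℤ.+ + x ℤ.* + c) ≡⟨ cong (λ z → ℤ.- (1ℤ ℤ.+ z)) (ℤ.pos-* x c) ⟨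
  ℤ.- (1ℤ ℤ.+ + (x * c))   ≡⟨ cong ℤ.-_ (ℤ.pos-+ 1 (x * c)) ⟨
  ℤ.- + (1 + x * c)        ≡⟨ cong (λ z → ℤ.- + z) 1+xc≡yn ⟩
  ℤ.- + (y * n)            ≡⟨ cong ℤ.-_ (ℤ.pos-* y n) ⟩
  ℤ.- (+ y ℤ.* + n)        ≡⟨ ℤ.neg-distribˡ-* (+ y) (+ n) ⟩
  ℤ.- + y ℤ.* + n          ∎))
  where
  open ≡-Reasoning
  negate : ∀ a b → a ℤ.* ℤ.- b ℤ.- 1ℤ ≡ ℤ.- (1ℤ ℤ.+ b ℤ.* a)
  negate = solve-∀

≡mod-inverse : ∀ {n} k → Coprime ∣ k ∣ n → ∃ λ s → k ℤ.* s ≡ 1ℤ mod n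
≡mod-inverse {n} k k⊥n with ℤ∣.m∣∣m∣ {k} | ≡mod-inverse⁺ k⊥n
... | divides σ ∣k∣≡σk | s , ∣k∣s≡1 = σ ℤ.* s , subst (_≡ 1ℤ mod n) ∣k∣s≡kσs ∣k∣s≡1
  where
  reassociate : ∀ a b c → a ℤ.* b ℤ.* c ≡ b ℤ.* (a ℤ.* c)
  reassociate = solve-∀
  ∣k∣s≡kσs : + ∣ k ∣ ℤ.* s ≡ k ℤ.* (σ ℤ.* s)
  ∣k∣s≡kσs = trans (cong (ℤ._* s) ∣k∣≡σk) (reassociate σ k s)

-- Lifting units

coprime-lift : ∀ {z D} M .{{_ : NonZero M}} → Coprime z D → ∃ λ c → Coprime (z + D * c) M
coprime-lift {z} {D} M z⊥D = c , subst (Coprime (z + D * c)) (sym isFactorisation)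
  (coprime-productʳ (All.tabulate (λ q∈ → Coprime.sym (prime-∤⇒coprime (prime q∈) (∤v q∈)))))
  where
  open PrimeFactorisation (factorise M)
  prime : ∀ {q} → q ∈ factors → Prime q
  prime = All.lookup factorsPrime
  ∤z? : (q : ℕ) → Dec (¬ q ∣ z)
  ∤z? q = ¬? (q ∣? z)
  c : ℕ
  c = product (filter ∤z? factors)
  -- Every prime factor q of M divides exactly one of z and D * c.
  ∤v : ∀ {q} → q ∈ factors → ¬ q ∣ z + D * c
  ∤v {q} q∈ q∣v with q ∣? z
  ... | yes q∣z = [ q∤D , q∤c ]′ (euclidsLemma D c (prime q∈) (∣m+n∣m⇒∣n q∣v q∣z))
    where
    q∤D : ¬ q ∣ D
    q∤D q∣D = ¬prime[1] (subst Prime (z⊥D (q∣z , q∣D)) (prime q∈))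
    q∤c : ¬ q ∣ c
    q∤c q∣c = proj₂ (∈-filter⁻ ∤z? {xs = factors}
      (factorisationHasAllPrimeFactors (prime q∈) q∣c (filter⁺ ∤z? factorsPrime))) q∣z
  ... | no q∤z = q∤z (∣m+n∣m⇒∣n (subst (q ∣_) (+-comm z (D * c)) q∣v)
                                (∣n⇒∣m*n D (∈⇒∣product (∈-filter⁺ ∤z? q∈ q∤z))))

-- The image of A_m under multiplication by k

coprime-solution : ∀ (k : ℤ) {N w} M .{{_ : NonZero N}} .{{_ : NonZero M}} → Coprime ∣ k ∣ N → Coprime w N
  → ∃ λ v → Coprime v M × k ℤ.* + v ≡ + w mod N
coprime-solution k {N} {w} M k⊥N w⊥N = z + N * c , z+Nc⊥M , (begin
  k ℤ.* + (z + N * c) ≈⟨ ≡mod-*ˡ k (≡mod-+-multiple z c) ⟩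
  k ℤ.* + z           ≈⟨ kz≡w ⟩
  + w                 ∎)
  where
  open ≡mod-Reasoning N
  s : ℤ
  s = proj₁ (≡mod-inverse k k⊥N)
  z : ℕ
  z = (s ℤ.* + w) %ℕ N
  kz≡w : k ℤ.* + z ≡ + w mod N
  kz≡w = begin
    k ℤ.* + z         ≈⟨ ≡mod-*ˡ k (%ℕ-≡mod (s ℤ.* + w)) ⟩
    k ℤ.* (s ℤ.* + w) ≡⟨ ℤ.*-assoc k s (+ w) ⟨
    k ℤ.* s ℤ.* + w   ≈⟨ ≡mod-*ʳ (+ w) (proj₂ (≡mod-inverse k k⊥N)) ⟩
    1ℤ ℤ.* + w        ≡⟨ ℤ.*-identityˡ (+ w) ⟩
    + w               ∎
  z⊥N : Coprime z N
  z⊥N (d∣z , d∣N) = w⊥N (≡mod-∣ d∣N d∣∣kz∣ kz≡w , d∣N)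
    where
    d∣∣kz∣ : _ ∣ ∣ k ℤ.* + z ∣
    d∣∣kz∣ = subst (_ ∣_) (sym (ℤ.abs-* k (+ z))) (∣n⇒∣m*n ∣ k ∣ d∣z)
  c : ℕ
  c = proj₁ (coprime-lift M z⊥N)
  z+Nc⊥M : Coprime (z + N * c) M
  z+Nc⊥M = proj₂ (coprime-lift M z⊥N)

preimage-in-Aₘ : ∀ (k : ℤ) {m g N w} n .{{_ : NonZero n}} → n ≡ m * g * N → Coprime ∣ k ∣ N → Coprime w N
  → ∃ λ a → A n m a × k ℤ.* + g ℤ.* + a ≡ + (w * (m * g)) mod n
preimage-in-Aₘ k {m} {g} {N} {w} _ refl k⊥N w⊥N = a , (n%ℕd<d (+ (m * v)) _ , gcd[a,n]≡m) , kga≡w[mg]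
  where
  instance
    mg≢0 : NonZero (m * g)
    mg≢0 = m*n≢0⇒m≢0 (m * g)
    m≢0 : NonZero m
    m≢0 = m*n≢0⇒m≢0 m
    N≢0 : NonZero N
    N≢0 = m*n≢0⇒n≢0 (m * g)
    gN≢0 : NonZero (g * N)
    gN≢0 = m*n≢0 g N {{m*n≢0⇒n≢0 m}}
  solution : ∃ λ v → Coprime v (g * N) × k ℤ.* + v ≡ + w mod N
  solution = coprime-solution k (g * N) k⊥N w⊥N
  v : ℕ
  v = proj₁ solution
  a : ℕ
  a = + (m * v) %ℕ (m * g * N)
  gcd[a,n]≡m : gcd a (m * g * N) ≡ m
  gcd[a,n]≡m = begin
    gcd a (m * g * N)         ≡⟨ ≡mod⇒gcd≡ (%ℕ-≡mod (+ (m * v))) ⟩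
    gcd (m * v) (m * g * N)   ≡⟨ cong (gcd (m * v)) (*-assoc m g N) ⟩
    gcd (m * v) (m * (g * N)) ≡⟨ c*gcd[m,n]≡gcd[cm,cn] m v (g * N) ⟨
    m * gcd v (g * N)         ≡⟨ cong (m *_) (coprime⇒gcd≡1 (proj₁ (proj₂ solution))) ⟩
    m * 1                     ≡⟨ *-identityʳ m ⟩
    m                         ∎
    where open ≡-Reasoning
  rearrange : ∀ a b c d → a ℤ.* b ℤ.* (c ℤ.* d) ≡ c ℤ.* b ℤ.* (a ℤ.* d)
  rearrange = solve-∀
  kga≡w[mg] : k ℤ.* + g ℤ.* + a ≡ + (w * (m * g)) mod (m * g * N)
  kga≡w[mg] = begin
    k ℤ.* + g ℤ.* + a            ≈⟨ ≡mod-*ˡ (k ℤ.* + g) (%ℕ-≡mod (+ (m * v))) ⟩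
    k ℤ.* + g ℤ.* + (m * v)      ≡⟨ cong (k ℤ.* + g ℤ.*_) (ℤ.pos-* m v) ⟩
    k ℤ.* + g ℤ.* (+ m ℤ.* + v)  ≡⟨ rearrange k (+ g) (+ m) (+ v) ⟩
    + m ℤ.* + g ℤ.* (k ℤ.* + v)  ≡⟨ cong (ℤ._* (k ℤ.* + v)) (ℤ.pos-* m g) ⟨
    + (m * g) ℤ.* (k ℤ.* + v)    ≈⟨ ≡mod-scale (m * g) (proj₂ (proj₂ solution)) ⟩
    + (m * g) ℤ.* + w            ≡⟨ trans (cong +_ (*-comm w (m * g))) (ℤ.pos-* (m * g) w) ⟨
    + (w * (m * g))              ∎
    where open ≡mod-Reasoning (m * g * N)

gcd[c*a,m*N]≡m*gcd[c,N] : ∀ c {a m N} .{{_ : NonZero m}} → gcd a (m * N) ≡ m → gcd (c * a) (m * N) ≡ m * gcd c N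
gcd[c*a,m*N]≡m*gcd[c,N] c {a} {m} {N} gcd[a,mN]≡m with subst (_∣ a) gcd[a,mN]≡m (gcd[m,n]∣m a (m * N))
... | divides v refl = begin
  gcd (c * (v * m)) (m * N) ≡⟨ cong (λ x → gcd x (m * N)) c[vm]≡m[vc] ⟩
  gcd (m * (v * c)) (m * N) ≡⟨ c*gcd[m,n]≡gcd[cm,cn] m (v * c) N ⟨
  m * gcd (v * c) N         ≡⟨ cong (m *_) (gcd[c*m,n]≡gcd[m,n] c v⊥N) ⟩
  m * gcd c N               ∎
  where
  open ≡-Reasoning
  c[vm]≡m[vc] : c * (v * m) ≡ m * (v * c)
  c[vm]≡m[vc] = trans (*-comm c (v * m)) (trans (cong (_* c) (*-comm v m)) (*-assoc m v c))
  v⊥N : Coprime v N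
  v⊥N = gcd[a*d,b*d]≡d⇒coprime (trans (cong (gcd (v * m)) (*-comm N m)) gcd[a,mN]≡m)

k·Aₘ⊆A[m*gcd[k,N]] : ∀ (k : ℤ) {m N} n .{{_ : NonZero n}} → n ≡ m * N → ∀ {y}
  → (k · A n m within n) y → A n (m * gcd (∣ k ∣) N) y
k·Aₘ⊆A[m*gcd[k,N]] k {m} {N} _ refl (a , (_ , gcd[a,n]≡m) , refl) = n%ℕd<d (k ℤ.* + a) (m * N) , (begin
  gcd ((k ℤ.* + a) %ℕ (m * N)) (m * N) ≡⟨ ≡mod⇒gcd≡ (%ℕ-≡mod (k ℤ.* + a)) ⟩
  gcd (∣ k ℤ.* + a ∣) (m * N)          ≡⟨ cong (λ x → gcd x (m * N)) (ℤ.abs-* k (+ a)) ⟩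
  gcd (∣ k ∣ * a) (m * N)              ≡⟨ gcd[c*a,m*N]≡m*gcd[c,N] ∣ k ∣ gcd[a,n]≡m ⟩
  m * gcd (∣ k ∣) N                    ∎)
  where
  open ≡-Reasoning
  instance
    m≢0 : NonZero m
    m≢0 = m*n≢0⇒m≢0 m

A[m*gcd[k,N]]⊆k·Aₘ : ∀ (k : ℤ) {m N} n .{{_ : NonZero n}} → n ≡ m * N → ∀ {y}
  → A n (m * gcd (∣ k ∣) N) y → (k · A n m within n) y
A[m*gcd[k,N]]⊆k·Aₘ k {m} {N} n n≡mN {y} (y<n , gcd[y,n]≡mg) =
  from-preimage (preimage-in-Aₘ k′ n n≡mgN′ k′⊥N′ w⊥N′)
  where
  open ≡-Reasoning
  g : ℕ
  g = gcd (∣ k ∣) N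
  instance
    mN≢0 : NonZero (m * N)
    mN≢0 = nonZero-resp n≡mN
    g≢0 : NonZero g
    g≢0 = ≢-nonZero (gcd[m,n]≢0 ∣ k ∣ N (inj₂ (≢-nonZero⁻¹ N {{m*n≢0⇒n≢0 m}})))
    mg≢0 : NonZero (m * g)
    mg≢0 = m*n≢0 m g {{m*n≢0⇒m≢0 m}}
  g∣k : + g ∣ℤ k
  g∣k = ℤ∣.∣ᵤ⇒∣ {+ g} {k} (gcd[m,n]∣m ∣ k ∣ N)
  k′ : ℤ
  k′ = ℤ∣._∣_.quotient g∣k
  k≡k′g : k ≡ k′ ℤ.* + g
  k≡k′g = ℤ∣._∣_.equality g∣k
  g∣N : g ∣ N
  g∣N = gcd[m,n]∣n ∣ k ∣ N
  N′ : ℕ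
  N′ = quotient g∣N
  mg∣y : m * g ∣ y
  mg∣y = subst (_∣ y) gcd[y,n]≡mg (gcd[m,n]∣m y n)
  w : ℕ
  w = quotient mg∣y
  y≡w[mg] : y ≡ w * (m * g)
  y≡w[mg] = m∣n⇒n≡quotient*m mg∣y
  n≡mgN′ : n ≡ m * g * N′
  n≡mgN′ = begin
    n            ≡⟨ n≡mN ⟩
    m * N        ≡⟨ cong (m *_) (m∣n⇒n≡m*quotient g∣N) ⟩
    m * (g * N′) ≡⟨ *-assoc m g N′ ⟨
    m * g * N′   ∎
  k′⊥N′ : Coprime ∣ k′ ∣ N′
  k′⊥N′ = gcd[a*d,b*d]≡d⇒coprime
    (cong₂ gcd (trans (sym (ℤ.abs-* k′ (+ g))) (cong ∣_∣ (sym k≡k′g))) (sym (m∣n⇒n≡quotient*m g∣N)))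
  w⊥N′ : Coprime w N′
  w⊥N′ = gcd[a*d,b*d]≡d⇒coprime
    (trans (cong₂ gcd (sym y≡w[mg]) (sym (trans n≡mgN′ (*-comm (m * g) N′)))) gcd[y,n]≡mg)
  from-preimage : (∃ λ a → A n m a × k′ ℤ.* + g ℤ.* + a ≡ + (w * (m * g)) mod n) → (k · A n m within n) y
  from-preimage (a , Aₘa , k′ga≡w[mg]) = a , Aₘa , (begin
    y                         ≡⟨ y≡w[mg] ⟩
    w * (m * g)               ≡⟨ m<n⇒m%n≡m (subst (_< n) y≡w[mg] y<n) ⟨
    + (w * (m * g)) %ℕ n      ≡⟨ ≡mod⇒%ℕ≡ (≡mod-sym k′ga≡w[mg]) ⟩
    (k′ ℤ.* + g ℤ.* + a) %ℕ n ≡⟨ cong (λ x → (x ℤ.* + a) %ℕ n) k≡k′g ⟨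
    (k ℤ.* + a) %ℕ n          ∎)

k·Aₘ⇔A[m*gcd[k,N]] : ∀ (k : ℤ) {m N} n .{{_ : NonZero n}} → n ≡ m * N
  → ∀ y → (k · A n m within n) y ⇔ A n (m * gcd (∣ k ∣) N) y
k·Aₘ⇔A[m*gcd[k,N]] k n n≡mN y = mk⇔ (k·Aₘ⊆A[m*gcd[k,N]] k n n≡mN) (A[m*gcd[k,N]]⊆k·Aₘ k n n≡mN)

lemma1 : (r t : ℕ) (p : Fin (r + t) → ℕ) → Injective _≡_ _≡_ p → (∀ i → Prime (p i))
    → (nₑ : Fin (r + t) → ℕ) (n : ℕ) .{{_ : NonZero n}} → n ≡ ∏ (λ i → p i ^ nₑ i)
    → (u : ℤ) → (∀ i → Coprime ∣ u ∣ (p i))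
    → (kₑ : Fin r → ℕ) (k : ℤ) → k ≡ u ℤ.* + ∏ (λ i → p (i ↑ˡ t) ^ kₑ i)
    → (mₑ : Fin (r + t) → ℕ) → (∀ i → mₑ i ≤ nₑ i)
    → (m : ℕ) → m ≡ ∏ (λ i → p i ^ mₑ i)
    → (m′ : ℕ) → m′ ≡ m * ∏ (λ i → p (i ↑ˡ t) ^ (kₑ i ⊓ (nₑ (i ↑ˡ t) ∸ mₑ (i ↑ˡ t))))
    → ∀ y → (k · A n m within n) y ⇔ A n m′ y
lemma1 r t p inj prime nₑ n n≡ u u⊥p kₑ k k≡ mₑ mₑ≤nₑ m m≡ m′ m′≡ y =
  subst (λ x → (k · A n m within n) y ⇔ A n x y) (sym m′≡m*gcd[k,N]) (k·Aₘ⇔A[m*gcd[k,N]] k n n≡mN y)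
  where
  open ≡-Reasoning
  dₑ : Fin (r + t) → ℕ
  dₑ i = nₑ i ∸ mₑ i
  N K : ℕ
  N = ∏ (λ i → p i ^ dₑ i)
  K = ∏ (λ i → p (i ↑ˡ t) ^ kₑ i)
  n≡mN : n ≡ m * N
  n≡mN = begin
    n                                      ≡⟨ n≡ ⟩
    ∏ (λ i → p i ^ nₑ i)                   ≡⟨ ∏-cong (λ i → cong (p i ^_) (m+[n∸m]≡n (mₑ≤nₑ i))) ⟨
    ∏ (λ i → p i ^ (mₑ i + dₑ i))          ≡⟨ ∏-cong (λ i → ^-distribˡ-+-* (p i) (mₑ i) (dₑ i)) ⟩
    ∏ (λ i → p i ^ mₑ i * p i ^ dₑ i)      ≡⟨ ∏-* (λ i → p i ^ mₑ i) (λ i → p i ^ dₑ i) ⟩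
    ∏ (λ i → p i ^ mₑ i) * N               ≡⟨ cong (_* N) m≡ ⟨
    m * N                                  ∎
  u⊥N : Coprime ∣ u ∣ N
  u⊥N = coprime-∏ʳ _ (λ i → coprime-^ʳ (dₑ i) (u⊥p i))
  m′≡m*gcd[k,N] : m′ ≡ m * gcd (∣ k ∣) N
  m′≡m*gcd[k,N] = begin
    m′                                                   ≡⟨ m′≡ ⟩
    m * ∏ (λ i → p (i ↑ˡ t) ^ (kₑ i ⊓ dₑ (i ↑ˡ t)))     ≡⟨ cong (m *_) (gcd-∏-^-↑ˡ p inj prime kₑ dₑ) ⟨
    m * gcd K N                                          ≡⟨ cong (m *_) (gcd[c*m,n]≡gcd[m,n] K u⊥N) ⟨
    m * gcd (∣ u ∣ * K) N                                ≡⟨ cong (λ x → m * gcd x N) (trans (cong ∣_∣ k≡) (ℤ.abs-* u (+ K))) ⟨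
    m * gcd (∣ k ∣) N                                    ∎
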